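{- For any string $S$, $|\mathsf{EBF}(S)|\le r(S)+l(S)-|V|+1$, where $V$ is the set of maximal substrings of $S$ (equivalently, the node set of the CDAWG of $S$).
   Context: Strings are over an alphabet $\Sigma$. $\mathrm{occ}_S(w)$ is the number of occurrences of $w$ in $S$, with $\mathrm{occ}_S(\varepsilon)=|S|+1$; $\mathrm{Substr}(S)$ is the set of substrings of $S$. $\mathsf{EBF}(S)$, the set of extended bispecial factors, consists of the strings $aub\in\mathrm{Substr}(S)$ with $a,b\in\Sigma$, $u\in\Sigma^*$, such that $a'u\in\mathrm{Substr}(S)$ for some character $a'\ne a$ and $ub'\in\mathrm{Substr}(S)$ for some character $b'\ne b$. A substring $u$ of $S$ (possibly empty) is left-maximal if $au,a'u\in\mathrm{Substr}(S)$ for some distinct characters $a\ne a'$ or $u$ is a prefix of $S$; right-maximal if $ub,ub'\in\mathrm{Substr}(S)$ for some distinct $b\ne b'$ or $u$ is a suffix of $S$; maximal if both. A maximal repeat is a maximal substring occurring at least twice (including $\varepsilon$). $r(S)=\sum_{u}|\{b\in\Sigma: ub\in\mathrm{Substr}(S)\}|$ and $l(S)=\sum_u|\{a\in\Sigma: au\in\mathrm{Substr}(S)\}|$, both sums over all maximal repeats $u$ of $S$. -}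

module Defs where

open import Data.Nat using (ℕ; _≤_; _+_)
open import Data.Product using (_×_; _,_; ∃; ∃-syntax; proj₁; proj₂)
open import Data.Sum using (_⊎_)
open import Data.List.Base using (List; []; _∷_; _∷ʳ_; _++_; length; filter; deduplicate; tails; inits; concatMap; cartesianProduct; map)
open import Data.Nat.ListAction using (sum)
open import Data.List.Properties using (≡-dec)
open import Data.List.Membership.Propositional using (_∈_; lose)
open import Data.List.Membership.Propositional.Properties using (∈-++⁺ʳ; ∈-deduplicate⁺)
open import Data.List.Relation.Unary.Any using (Any; here; there; any?; satisfied)
open import Data.List.Relation.Binary.Infix.Heterogeneous using (Infix)
open import Data.List.Relation.Binary.Infix.Heterogeneous.Properties using (infix?)
open import Data.List.Relation.Binary.Prefix.Heterogeneous using (Prefix)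
open import Data.List.Relation.Binary.Prefix.Heterogeneous.Properties using (prefix?)
open import Data.List.Relation.Binary.Suffix.Heterogeneous using (Suffix)
open import Data.List.Relation.Binary.Suffix.Heterogeneous.Properties using (suffix?)
open import Relation.Binary.PropositionalEquality using (_≡_; _≢_; refl)
open import Relation.Binary.Definitions using (DecidableEquality)
open import Relation.Nullary using (Dec; yes; no; ¬?)
open import Relation.Nullary.Decidable using (_×-dec_; _⊎-dec_; map′)
open import Data.Nat.Properties using (_≤?_)

bounded∃? : {A : Set} {P : A → Set} (xs : List A) →
            (∀ a → Dec (P a)) → (∀ {a} → P a → a ∈ xs) → Dec (∃ P)
bounded∃? xs P? bound =
  map′ satisfied (λ (a , pa) → lose (bound pa) pa) (any? P? xs)

module Strings {Σ : Set} (_≟_ : DecidableEquality Σ) where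

  _≟ˢ_ : DecidableEquality (List Σ)
  _≟ˢ_ = ≡-dec _≟_

  IsSubstr : List Σ → List Σ → Set
  IsSubstr u S = Infix _≡_ u S

  substr? : ∀ u S → Dec (IsSubstr u S)
  substr? u S = infix? _≟_ u S

  substrs : List Σ → List (List Σ)
  substrs S = deduplicate _≟ˢ_ (concatMap inits (tails S))

  chars : List Σ → List Σ
  chars S = deduplicate _≟_ S

  -- occ_S(w): number of start positions i ∈ {0,…,|S|} at which w occurs
  -- in S (so occ_S(ε) = |S| + 1)
  occ : List Σ → List Σ → ℕ
  occ S w = length (filter (λ t → prefix? _≟_ w t) (tails S))

  private
    prefix-∈ : ∀ {x : Σ} {xs S : List Σ} → Prefix _≡_ xs S → x ∈ xs → x ∈ S
    prefix-∈ (refl Prefix.∷ p) (here refl) = here refl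
    prefix-∈ (refl Prefix.∷ p) (there i) = there (prefix-∈ p i)

    infix-∈ : ∀ {x : Σ} {xs S : List Σ} → Infix _≡_ xs S → x ∈ xs → x ∈ S
    infix-∈ (Infix.here p) i = prefix-∈ p i
    infix-∈ (Infix.there q) i = there (infix-∈ q i)

    ∈-∷ʳ : ∀ (u : List Σ) b → b ∈ u ∷ʳ b
    ∈-∷ʳ u b = ∈-++⁺ʳ u (here refl)

  head∈chars : ∀ {a : Σ} {u S : List Σ} → IsSubstr (a ∷ u) S → a ∈ chars S
  head∈chars p = ∈-deduplicate⁺ _≟_ (infix-∈ p (here refl))

  last∈chars : ∀ {u : List Σ} {b : Σ} {S : List Σ} → IsSubstr (u ∷ʳ b) S → b ∈ chars S
  last∈chars {u} {b} p = ∈-deduplicate⁺ _≟_ (infix-∈ p (∈-∷ʳ u b))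

  LeftMaximal : List Σ → List Σ → Set
  LeftMaximal S u =
    (∃[ a ] ∃[ a' ] (a ≢ a' × IsSubstr (a ∷ u) S × IsSubstr (a' ∷ u) S))
    ⊎ Prefix _≡_ u S

  RightMaximal : List Σ → List Σ → Set
  RightMaximal S u =
    (∃[ b ] ∃[ b' ] (b ≢ b' × IsSubstr (u ∷ʳ b) S × IsSubstr (u ∷ʳ b') S))
    ⊎ Suffix _≡_ u S

  Maximal : List Σ → List Σ → Set
  Maximal S u = LeftMaximal S u × RightMaximal S u

  MaximalRepeat : List Σ → List Σ → Set
  MaximalRepeat S u = Maximal S u × 2 ≤ occ S u

  leftMaximal? : ∀ S u → Dec (LeftMaximal S u)
  leftMaximal? S u =
    bounded∃? (chars S)
      (λ a → bounded∃? (chars S)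
               (λ a' → ¬? (a ≟ a') ×-dec substr? (a ∷ u) S ×-dec substr? (a' ∷ u) S)
               (λ q → head∈chars (proj₂ (proj₂ q))))
      (λ q → head∈chars (proj₁ (proj₂ (proj₂ q))))
    ⊎-dec prefix? _≟_ u S

  rightMaximal? : ∀ S u → Dec (RightMaximal S u)
  rightMaximal? S u =
    bounded∃? (chars S)
      (λ b → bounded∃? (chars S)
               (λ b' → ¬? (b ≟ b') ×-dec substr? (u ∷ʳ b) S ×-dec substr? (u ∷ʳ b') S)
               (λ q → last∈chars {u} (proj₂ (proj₂ q))))
      (λ q → last∈chars {u} (proj₁ (proj₂ (proj₂ q))))
    ⊎-dec suffix? _≟_ u S

  maximal? : ∀ S u → Dec (Maximal S u)
  maximal? S u = leftMaximal? S u ×-dec rightMaximal? S u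

  maximalRepeat? : ∀ S u → Dec (MaximalRepeat S u)
  maximalRepeat? S u = maximal? S u ×-dec (2 ≤? occ S u)

  V : List Σ → List (List Σ)
  V S = filter (maximal? S) (substrs S)

  maxRepeats : List Σ → List (List Σ)
  maxRepeats S = filter (maximalRepeat? S) (substrs S)

  -- {b ∈ Σ : ub ∈ Substr(S)}  and  {a ∈ Σ : au ∈ Substr(S)}
  -- (any such character occurs in S, so it suffices to scan chars S)
  rightExt : List Σ → List Σ → List Σ
  rightExt S u = filter (λ b → substr? (u ∷ʳ b) S) (chars S)

  leftExt : List Σ → List Σ → List Σ
  leftExt S u = filter (λ a → substr? (a ∷ u) S) (chars S)

  r : List Σ → ℕ
  r S = sum (map (λ u → length (rightExt S u)) (maxRepeats S))

  l : List Σ → ℕ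
  l S = sum (map (λ u → length (leftExt S u)) (maxRepeats S))

  -- Extended bispecial factors.  An element a·u·b of EBF(S) is recorded
  -- as the triple (a , u , b); since (a , u , b) ↦ a ∷ u ∷ʳ b is
  -- injective, the number of such triples is |EBF(S)|.

  IsEBF : List Σ → Σ × List Σ × Σ → Set
  IsEBF S (a , u , b) =
    IsSubstr (a ∷ (u ∷ʳ b)) S
    × (∃[ a' ] (a' ≢ a × IsSubstr (a' ∷ u) S))
    × (∃[ b' ] (b' ≢ b × IsSubstr (u ∷ʳ b') S))

  isEBF? : ∀ S t → Dec (IsEBF S t)
  isEBF? S (a , u , b) =
    substr? (a ∷ (u ∷ʳ b)) S
    ×-dec bounded∃? (chars S) (λ a' → ¬? (a' ≟ a) ×-dec substr? (a' ∷ u) S)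
                    (λ q → head∈chars (proj₂ q))
    ×-dec bounded∃? (chars S) (λ b' → ¬? (b' ≟ b) ×-dec substr? (u ∷ʳ b') S)
                    (λ q → last∈chars {u} (proj₂ q))

  -- every triple in EBF(S) has a, b ∈ chars S and u ∈ Substr(S),
  -- so EBF(S) is enumerated by filtering this duplicate-free list
  EBF : List Σ → List (Σ × List Σ × Σ)
  EBF S = filter (isEBF? S)
            (cartesianProduct (chars S) (cartesianProduct (substrs S) (chars S)))

{-# OPTIONS --safe #-}
module Submission where

-- For a substring w of S let L(w), R(w) and E(w) count the characters a, the
-- characters b and the pairs (a , b) for which a ∷ w, w ∷ʳ b and a ∷ w ∷ʳ b are
-- substrings.  Reading off the first character, the last character, or both,
-- of the distinct substrings gives ΣL = ΣR = N - 1 and ΣE = N - 1 - σ, where N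
-- is the number of substrings and σ the number of distinct characters.  A
-- substring that is not a maximal repeat satisfies L(w) + R(w) ≤ E(w) + 1:
-- either it occurs once, or all its occurrences are preceded (followed) by the
-- same character c and then b ↦ (c , b) injects its right extensions into its
-- pairs.  Hence Σ (L + R) ≥ Σ (E + 1) + σ - 1 over the maximal repeats.  Now
-- a ∷ u ∷ʳ b ∈ EBF(S) forces u to be a maximal repeat, so |EBF| ≤ Σ E over
-- them, and a maximal substring occurring once is S itself, so |V| ≤ |MR| + 1.
-- This gives the bound whenever σ ≥ 1; the empty string is checked directly.

open import Defs
open import Data.Nat using (ℕ; suc; _≤_; _<_; _+_; z≤n; s≤s)
open import Data.Nat.Properties
  using (_≤?_; ≤-trans; ≤-reflexive; +-comm; +-mono-≤; +-monoˡ-≤; +-monoʳ-≤; +-cancelʳ-≤; +-assoc; +-suc;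
         +-commutativeSemigroup; n≤1+n;
         <-cmp; suc-injective; module ≤-Reasoning)
open import Data.Nat.ListAction using (sum)
open import Algebra.Properties.CommutativeSemigroup +-commutativeSemigroup using (interchange; x∙yz≈y∙xz)
open import Data.Nat.Tactic.RingSolver using (solve-∀)
open import Data.Product using (_×_; _,_; ∃-syntax; ∃₂; proj₁; proj₂)
open import Data.Sum using (inj₁; inj₂)
open import Data.Empty using (⊥-elim)
open import Data.List.Base
  using (List; []; _∷_; _∷ʳ_; _++_; [_]; length; filter; map; cartesianProduct; concatMap; inits; tails;
         initLast; _∷ʳ′_)
open import Data.List.Properties
  using (length-map; length-++; length-++-sucʳ; ++-identityʳ; ++-assoc; ++-cancelˡ; ++-conicalʳ; ∷-injective; ∷-injectiveˡ;
         ∷ʳ-injective; ∷ʳ-injectiveʳ; filter-++; filter-accept; filter-reject)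
open import Data.List.Membership.Propositional using (_∈_)
open import Data.List.Membership.Propositional.Properties
  using (∈-length; ∈-map⁺; ∈-map⁻; ∈-++⁺ˡ; ∈-++⁺ʳ; ∈-++⁻; ∈-∃++; ∈-filter⁺; ∈-filter⁻; ∈-cartesianProduct⁺;
         ∈-cartesianProduct⁻; ∈-deduplicate⁺; ∈-deduplicate⁻)
open import Data.List.Relation.Binary.Subset.Propositional using (_⊆_)
open import Data.List.Relation.Binary.Pointwise using (Pointwise-≡⇒≡; ≡⇒Pointwise-≡)
import Data.List.Relation.Binary.Prefix.Heterogeneous as Prefix
open Prefix using (Prefix; []; _∷_)
import Data.List.Relation.Binary.Suffix.Heterogeneous as Suffix
open Suffix using (Suffix)
import Data.List.Relation.Binary.Infix.Heterogeneous as Infix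
open Infix using (here; there)
open import Data.List.Relation.Binary.Prefix.Heterogeneous.Properties using (prefix?)
open import Data.List.Relation.Unary.Any using (here; there)
open import Data.List.Relation.Unary.All as All using (_∷_)
open import Data.List.Relation.Unary.AllPairs using ([]; _∷_)
open import Data.List.Relation.Unary.Unique.Propositional using (Unique)
import Data.List.Relation.Unary.Unique.Propositional.Properties as Unique
open import Data.List.Relation.Unary.Unique.DecPropositional.Properties using (deduplicate-!)
open import Function.Base using (_∘_)
open import Function.Definitions using (Injective)
open import Relation.Binary.Definitions using (DecidableEquality; tri<; tri≈; tri>)
open import Relation.Binary.PropositionalEquality
  using (_≡_; _≢_; refl; sym; trans; cong; cong₂; subst; module ≡-Reasoning)
open import Relation.Nullary using (¬_; Dec; yes; no)
open import Relation.Nullary.Decidable using (decidable-stable)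
open import Relation.Unary using (Decidable)
open import Relation.Unary.Properties using (∁?)

private variable
  X Y : Set

++-injective : ∀ (p p' : List X) {u v} → length p ≡ length p' → p ++ u ≡ p' ++ v → p ≡ p' × u ≡ v
++-injective []      []        _   eq = refl , eq
++-injective (c ∷ p) (c' ∷ p') len eq with refl , eq′ ← ∷-injective eq
  with refl , u≡v ← ++-injective p p' (suc-injective len) eq′ = refl , u≡v

Unique-⊆⇒length≤ : {xs ys : List X} → Unique xs → xs ⊆ ys → length xs ≤ length ys
Unique-⊆⇒length≤ [] _ = z≤n
Unique-⊆⇒length≤ {xs = x ∷ xs} (x∉xs ∷ xs!) xs⊆ys with us , vs , refl ← ∈-∃++ (xs⊆ys (here refl)) =
  ≤-trans (s≤s (Unique-⊆⇒length≤ xs! xs⊆us++vs)) (≤-reflexive (sym (length-++-sucʳ us x vs)))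
  where
  xs⊆us++vs : xs ⊆ us ++ vs
  xs⊆us++vs {y} y∈xs with ∈-++⁻ us (xs⊆ys (there y∈xs))
  ... | inj₁ y∈us        = ∈-++⁺ˡ y∈us
  ... | inj₂ (here refl) = ⊥-elim (All.lookup x∉xs y∈xs refl)
  ... | inj₂ (there y∈vs) = ∈-++⁺ʳ us y∈vs

Unique-constant⇒length≤1 : {xs : List X} → Unique xs → (∀ {x y} → x ∈ xs → y ∈ xs → x ≡ y) →
                           length xs ≤ 1
Unique-constant⇒length≤1 []             _ = z≤n
Unique-constant⇒length≤1 (_ ∷ [])       _ = s≤s z≤n
Unique-constant⇒length≤1 ((x≢y ∷ _) ∷ _) constant = ⊥-elim (x≢y (constant (here refl) (there (here refl))))

injective⇒length≤ : (f : X → Y) → Injective _≡_ _≡_ f → {xs : List X} {ys : List Y} →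
                    Unique xs → (∀ {x} → x ∈ xs → f x ∈ ys) → length xs ≤ length ys
injective⇒length≤ f f-inj {xs} xs! f[xs]⊆ys =
  ≤-trans (≤-reflexive (sym (length-map f xs))) (Unique-⊆⇒length≤ (Unique.map⁺ f-inj xs!) image⊆ys)
  where
  image⊆ys : map f xs ⊆ _
  image⊆ys y∈ with x , x∈xs , refl ← ∈-map⁻ f y∈ = f[xs]⊆ys x∈xs

length-+-length≤suc : (xs : List X) (ys : List Y) {n : ℕ} → length xs ≤ 1 → length ys ≤ 1 →
                      (∀ {x y} → x ∈ xs → y ∈ ys → 1 ≤ n) → length xs + length ys ≤ suc n
length-+-length≤suc []           ys       _ ys≤1 _ = ≤-trans ys≤1 (s≤s z≤n)
length-+-length≤suc (_ ∷ [])     []       _    _ _ = s≤s z≤n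
length-+-length≤suc (_ ∷ [])     (_ ∷ []) _    _ both = s≤s (both (here refl) (here refl))
length-+-length≤suc (_ ∷ _ ∷ _)  _        (s≤s ()) _ _
length-+-length≤suc (_ ∷ [])     (_ ∷ _ ∷ _) _ (s≤s ()) _

sum-+-sum≤sum-+-length : (f g h : X → ℕ) (xs : List X) → (∀ {x} → x ∈ xs → f x + g x ≤ suc (h x)) →
                         sum (map f xs) + sum (map g xs) ≤ sum (map h xs) + length xs
sum-+-sum≤sum-+-length f g h []       _     = z≤n
sum-+-sum≤sum-+-length f g h (x ∷ xs) bound = begin
  (f x + F) + (g x + G)        ≡⟨ interchange (f x) F (g x) G ⟩
  (f x + g x) + (F + G)        ≤⟨ +-mono-≤ (bound (here refl)) (sum-+-sum≤sum-+-length f g h xs (bound ∘ there)) ⟩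
  suc (h x) + (H + length xs)  ≡⟨ cong suc (+-assoc (h x) H (length xs)) ⟨
  suc ((h x + H) + length xs)  ≡⟨ +-suc (h x + H) (length xs) ⟨
  (h x + H) + suc (length xs)  ∎
  where
  open ≤-Reasoning
  F = sum (map f xs)
  G = sum (map g xs)
  H = sum (map h xs)

module _ {X : Set} {P : X → Set} (P? : Decidable P) where

  length-filter+filter-∁ : ∀ xs → length xs ≡ length (filter P? xs) + length (filter (∁? P?) xs)
  length-filter+filter-∁ []       = refl
  length-filter+filter-∁ (x ∷ xs) with P? x
  ... | yes _ = cong suc (length-filter+filter-∁ xs)
  ... | no  _ = trans (cong suc (length-filter+filter-∁ xs)) (sym (+-suc _ _))

  sum-filter+filter-∁ : ∀ (f : X → ℕ) xs →
                        sum (map f xs) ≡ sum (map f (filter P? xs)) + sum (map f (filter (∁? P?) xs))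
  sum-filter+filter-∁ f []       = refl
  sum-filter+filter-∁ f (x ∷ xs) with P? x | sum-filter+filter-∁ f xs
  ... | yes _ | ih = trans (cong (f x +_) ih) (sym (+-assoc (f x) (sum (map f (filter P? xs))) _))
  ... | no  _ | ih = trans (cong (f x +_) ih) (x∙yz≈y∙xz (f x) (sum (map f (filter P? xs))) _)

module _ {X Y : Set} {Q : X × Y → Set} (Q? : Decidable Q) where

  length-filter-cartesianProduct :
    ∀ xs ys → length (filter Q? (cartesianProduct xs ys)) ≡ sum (map (λ x → length (filter (Q? ∘ (x ,_)) ys)) xs)
  length-filter-cartesianProduct []       ys = refl
  length-filter-cartesianProduct (x ∷ xs) ys = begin
    length (filter Q? (map (x ,_) ys ++ cartesianProduct xs ys))
      ≡⟨ cong length (filter-++ Q? (map (x ,_) ys) _) ⟩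
    length (filter Q? (map (x ,_) ys) ++ filter Q? (cartesianProduct xs ys))
      ≡⟨ length-++ (filter Q? (map (x ,_) ys)) ⟩
    length (filter Q? (map (x ,_) ys)) + length (filter Q? (cartesianProduct xs ys))
      ≡⟨ cong₂ _+_ (length-filter-map x ys) (length-filter-cartesianProduct xs ys) ⟩
    _ ∎
    where
    open ≡-Reasoning
    length-filter-map : ∀ x ys → length (filter Q? (map (x ,_) ys)) ≡ length (filter (Q? ∘ (x ,_)) ys)
    length-filter-map x []       = refl
    length-filter-map x (y ∷ ys) with Q? (x , y)
    ... | yes _ = cong suc (length-filter-map x ys)
    ... | no  _ = length-filter-map x ys

-- n, m and o count all substrings, the maximal repeats and the others, σ the characters;
-- lX, rX and eX are the sums over those classes of left, right and two-sided extensions.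
extension-count-arith : ∀ {n m o σ eM eO lM lO rM rO} → n ≡ m + o →
                        n ≤ suc (lM + lO) → n ≤ suc (rM + rO) → suc (σ + (eM + eO)) ≤ n → lO + rO ≤ eO + o →
                        m + σ + eM ≤ suc (lM + rM)
extension-count-arith {m = m} {o} {σ} {eM} {eO} {lM} {lO} {rM} {rO} refl n≤L n≤R E≤n others =
  +-cancelʳ-≤ (suc (eO + o)) (m + σ + eM) (suc (lM + rM)) (begin
    (m + σ + eM) + suc (eO + o)    ≡⟨ regroupˡ m o σ eM eO ⟩
    suc (σ + (eM + eO)) + (m + o)  ≤⟨ +-monoˡ-≤ (m + o) E≤n ⟩
    (m + o) + (m + o)              ≤⟨ +-mono-≤ n≤L n≤R ⟩
    suc (lM + lO) + suc (rM + rO)  ≡⟨ regroupʳ lM lO rM rO ⟩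
    suc (lM + rM) + suc (lO + rO)  ≤⟨ +-monoʳ-≤ (suc (lM + rM)) (s≤s others) ⟩
    suc (lM + rM) + suc (eO + o)   ∎)
  where
  open ≤-Reasoning
  regroupˡ : ∀ m o σ eM eO → (m + σ + eM) + suc (eO + o) ≡ suc (σ + (eM + eO)) + (m + o)
  regroupˡ = solve-∀
  regroupʳ : ∀ lM lO rM rO → suc (lM + lO) + suc (rM + rO) ≡ suc (lM + rM) + suc (lO + rO)
  regroupʳ = solve-∀

module Substrings {A : Set} (_≟_ : DecidableEquality A) where
  open Strings _≟_

  Factor : List A → List A → Set
  Factor x S = ∃₂ λ p q → p ++ x ++ q ≡ S

  private variable
    a b : A
    p q u v x S : List A

  ++⇒prefix : x ++ q ≡ S → Prefix _≡_ x S
  ++⇒prefix {q = q} refl = Prefix.fromView (≡⇒Pointwise-≡ refl Prefix.++ q)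

  prefix⇒++ : Prefix _≡_ x S → ∃[ q ] x ++ q ≡ S
  prefix⇒++ pre with pw Prefix.++ q ← Prefix.toView pre = q , cong (_++ q) (Pointwise-≡⇒≡ pw)

  ++⇒suffix : p ++ x ≡ S → Suffix _≡_ x S
  ++⇒suffix {p = p} refl = Suffix.fromView (p Suffix.++ ≡⇒Pointwise-≡ refl)

  suffix⇒++ : Suffix _≡_ x S → ∃[ p ] p ++ x ≡ S
  suffix⇒++ suf with p Suffix.++ pw ← Suffix.toView suf = p , cong (p ++_) (Pointwise-≡⇒≡ pw)

  factor⇒substr : Factor x S → IsSubstr x S
  factor⇒substr (p , q , refl) = Infix.fromView (Infix.MkView p (≡⇒Pointwise-≡ refl) q)

  substr⇒factor : IsSubstr x S → Factor x S
  substr⇒factor i with Infix.MkView p pw q ← Infix.toView i = p , q , cong (λ y → p ++ y ++ q) (Pointwise-≡⇒≡ pw)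

  prefix-++⁻ : Prefix _≡_ (u ++ v) S → Prefix _≡_ u S
  prefix-++⁻ {u} {v} pre with q , eq ← prefix⇒++ pre = ++⇒prefix (trans (sym (++-assoc u v q)) eq)

  suffix-∷⁻ : Suffix _≡_ (a ∷ u) S → Suffix _≡_ u S
  suffix-∷⁻ {a} {u} suf with p , eq ← suffix⇒++ suf = ++⇒suffix (trans (++-assoc p [ a ] u) eq)

  ∈-inits⁻ : ∀ t → x ∈ inits t → Prefix _≡_ x t
  ∈-inits⁻ t       (here refl) = []
  ∈-inits⁻ (c ∷ t) (there x∈) with y , y∈ , refl ← ∈-map⁻ (c ∷_) {xs = inits t} x∈ = refl ∷ ∈-inits⁻ t y∈

  ∈-inits⁺ : Prefix _≡_ x S → x ∈ inits S
  ∈-inits⁺ []           = here refl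
  ∈-inits⁺ (refl ∷ pre) = there (∈-map⁺ _ (∈-inits⁺ pre))

  ∈-substrs⁻ : x ∈ substrs S → IsSubstr x S
  ∈-substrs⁻ {S = S} x∈ = go S (∈-deduplicate⁻ _≟ˢ_ (concatMap inits (tails S)) x∈)
    where
    go : ∀ S → x ∈ concatMap inits (tails S) → IsSubstr x S
    go []      x∈ with inj₁ x∈inits ← ∈-++⁻ (inits []) x∈ = here (∈-inits⁻ [] x∈inits)
    go (c ∷ S) x∈ with ∈-++⁻ (inits (c ∷ S)) x∈
    ... | inj₁ x∈inits = here (∈-inits⁻ (c ∷ S) x∈inits)
    ... | inj₂ x∈rest  = there (go S x∈rest)

  ∈-substrs⁺ : IsSubstr x S → x ∈ substrs S
  ∈-substrs⁺ = ∈-deduplicate⁺ _≟ˢ_ ∘ go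
    where
    go : IsSubstr x S → x ∈ concatMap inits (tails S)
    go (here pre)      = ∈-++⁺ˡ (∈-inits⁺ pre)
    go (there {c} sub) = ∈-++⁺ʳ (inits (c ∷ _)) (go sub)

  ∈⇒singleton-substr : a ∈ S → IsSubstr [ a ] S
  ∈⇒singleton-substr (here refl) = here (refl ∷ [])
  ∈⇒singleton-substr (there a∈)  = there (∈⇒singleton-substr a∈)

  factor-∷ : ∀ p x → p ++ (a ∷ x) ++ q ≡ S → (p ∷ʳ a) ++ x ++ q ≡ S
  factor-∷ {a} {q} p x eq = trans (++-assoc p [ a ] (x ++ q)) eq

  factor-∷ʳ : ∀ p x → p ++ (x ∷ʳ b) ++ q ≡ S → p ++ x ++ (b ∷ q) ≡ S
  factor-∷ʳ {b} {q} p x eq = trans (cong (p ++_) (sym (++-assoc x [ b ] q))) eq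

  substr-++ˡ : ∀ u v → IsSubstr (u ++ v) S → IsSubstr u S
  substr-++ˡ u v sub with p , q , eq ← substr⇒factor sub =
    factor⇒substr (p , v ++ q , trans (cong (p ++_) (sym (++-assoc u v q))) eq)

  substr-++ʳ : ∀ u v → IsSubstr (u ++ v) S → IsSubstr v S
  substr-++ʳ u v sub with p , q , eq ← substr⇒factor sub =
    factor⇒substr (p ++ u , q , trans (trans (++-assoc p u (v ++ q)) (cong (p ++_) (sym (++-assoc u v q)))) eq)

  occ-∷-prefix : ∀ c S → Prefix _≡_ x (c ∷ S) → occ (c ∷ S) x ≡ suc (occ S x)
  occ-∷-prefix {x} c S pre = cong length (filter-accept (prefix? _≟_ x) pre)

  occ-∷ : ∀ c S → occ S x ≤ occ (c ∷ S) x
  occ-∷ {x} c S = by-cases (prefix? _≟_ x (c ∷ S))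
    where
    by-cases : Dec (Prefix _≡_ x (c ∷ S)) → occ S x ≤ occ (c ∷ S) x
    by-cases (yes pre) = ≤-trans (n≤1+n _) (≤-reflexive (sym (occ-∷-prefix c S pre)))
    by-cases (no ¬pre) = ≤-reflexive (sym (cong length (filter-reject (prefix? _≟_ x) ¬pre)))

  occ≥1 : ∀ p → p ++ x ++ q ≡ S → 1 ≤ occ S x
  occ≥1 {x} [] eq = subst (1 ≤_) (sym (cong length (filter-accept (prefix? _≟_ x) (++⇒prefix eq)))) (s≤s z≤n)
  occ≥1 {x} (c ∷ p) refl = ≤-trans (occ≥1 {x} p refl) (occ-∷ {x} c _)

  occ≥2 : ∀ p p' {q q'} → p ++ x ++ q ≡ S → p' ++ x ++ q' ≡ S → length p < length p' → 2 ≤ occ S x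
  occ≥2 {x} []      (c ∷ p') eq refl _ =
    subst (2 ≤_) (sym (occ-∷-prefix {x} c _ (++⇒prefix eq))) (s≤s (occ≥1 {x} p' refl))
  occ≥2 {x} (c ∷ p) (c' ∷ p') refl eq' (s≤s p<p') with refl , eq″ ← ∷-injective eq' =
    ≤-trans (occ≥2 {x} p p' refl eq″ p<p') (occ-∷ {x} c _)

  distinct-factorisations⇒occ≥2 : ∀ p p' {q q'} → p ++ x ++ q ≡ S → p' ++ x ++ q' ≡ S → p ≢ p' →
                                  2 ≤ occ S x
  distinct-factorisations⇒occ≥2 {x} p p' eq eq' p≢p' with <-cmp (length p) (length p')
  ... | tri< p<p' _ _ = occ≥2 {x} p p' eq eq' p<p'
  ... | tri≈ _ len _  = ⊥-elim (p≢p' (proj₁ (++-injective p p' len (trans eq (sym eq')))))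
  ... | tri> _ _ p>p' = occ≥2 {x} p' p eq' eq p>p'

  occurs-once⇒unique-factorisation : ¬ 2 ≤ occ S x → ∀ p p' {q q'} → p ++ x ++ q ≡ S → p' ++ x ++ q' ≡ S →
                                     p ≡ p'
  occurs-once⇒unique-factorisation {x = x} occ<2 p p' eq eq' =
    decidable-stable (p ≟ˢ p') (occ<2 ∘ distinct-factorisations⇒occ≥2 {x} p p' eq eq')

  ¬prefix⇒leftExtensible : IsSubstr u S → ¬ Prefix _≡_ u S → ∃[ c ] IsSubstr (c ∷ u) S
  ¬prefix⇒leftExtensible {u} sub ¬pre with p , q , eq ← substr⇒factor sub | initLast p
  ... | []       = ⊥-elim (¬pre (++⇒prefix eq))
  ... | p₀ ∷ʳ′ c = c , factor⇒substr (p₀ , q , trans (sym (++-assoc p₀ [ c ] (u ++ q))) eq)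

  ¬suffix⇒rightExtensible : IsSubstr u S → ¬ Suffix _≡_ u S → ∃[ c ] IsSubstr (u ∷ʳ c) S
  ¬suffix⇒rightExtensible {u} sub ¬suf with substr⇒factor sub
  ... | p , []    , eq = ⊥-elim (¬suf (++⇒suffix (trans (cong (p ++_) (sym (++-identityʳ u))) eq)))
  ... | p , c ∷ q , eq = c , factor⇒substr (p , q , trans (cong (p ++_) (++-assoc u [ c ] q)) eq)

module Extensions {A : Set} (_≟_ : DecidableEquality A) (S : List A) where
  open Strings _≟_
  open Substrings _≟_

  private variable
    a b : A
    u w : List A

  LeftSpecial RightSpecial : List A → Set
  LeftSpecial  u = ∃[ a ] ∃[ a' ] (a ≢ a' × IsSubstr (a ∷ u) S × IsSubstr (a' ∷ u) S)
  RightSpecial u = ∃[ b ] ∃[ b' ] (b ≢ b' × IsSubstr (u ∷ʳ b) S × IsSubstr (u ∷ʳ b') S)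

  leftSpecial⇒occ≥2 : ∀ u → LeftSpecial u → 2 ≤ occ S u
  leftSpecial⇒occ≥2 u (a , a' , a≢a' , sub , sub')
    with p , _ , eq ← substr⇒factor sub | p' , _ , eq' ← substr⇒factor sub' =
    distinct-factorisations⇒occ≥2 {u} (p ∷ʳ a) (p' ∷ʳ a') (factor-∷ p u eq) (factor-∷ p' u eq')
      (a≢a' ∘ ∷ʳ-injectiveʳ p p')

  rightSpecial⇒occ≥2 : ∀ u → RightSpecial u → 2 ≤ occ S u
  rightSpecial⇒occ≥2 u (b , b' , b≢b' , sub , sub')
    with p , _ , eq ← substr⇒factor sub | p' , _ , eq' ← substr⇒factor sub' =
    distinct-factorisations⇒occ≥2 {u} p p' (factor-∷ʳ p u eq) (factor-∷ʳ p' u eq') p≢p'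
    where
    p≢p' : p ≢ p'
    p≢p' refl =
      b≢b' (∷-injectiveˡ (++-cancelˡ u _ _ (++-cancelˡ p _ _ (trans (factor-∷ʳ p u eq) (sym (factor-∷ʳ p u eq'))))))

  ¬leftSpecial⇒unique : ¬ LeftSpecial u → IsSubstr (a ∷ u) S → IsSubstr (b ∷ u) S → a ≡ b
  ¬leftSpecial⇒unique {a = a} {b} ¬ls sub sub' = decidable-stable (a ≟ b) λ a≢b → ¬ls (a , b , a≢b , sub , sub')

  ¬rightSpecial⇒unique : ¬ RightSpecial u → IsSubstr (u ∷ʳ a) S → IsSubstr (u ∷ʳ b) S → a ≡ b
  ¬rightSpecial⇒unique {a = a} {b} ¬rs sub sub' = decidable-stable (a ≟ b) λ a≢b → ¬rs (a , b , a≢b , sub , sub')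

  ∈-leftExt⁻ : ∀ u → a ∈ leftExt S u → IsSubstr (a ∷ u) S
  ∈-leftExt⁻ u = proj₂ ∘ ∈-filter⁻ (λ a → substr? (a ∷ u) S) {xs = chars S}

  ∈-rightExt⁻ : ∀ u → b ∈ rightExt S u → IsSubstr (u ∷ʳ b) S
  ∈-rightExt⁻ u = proj₂ ∘ ∈-filter⁻ (λ b → substr? (u ∷ʳ b) S) {xs = chars S}

  chars-unique : Unique (chars S)
  chars-unique = deduplicate-! _≟_ S

  ¬leftSpecial⇒length-leftExt≤1 : ∀ u → ¬ LeftSpecial u → length (leftExt S u) ≤ 1
  ¬leftSpecial⇒length-leftExt≤1 u ¬ls = Unique-constant⇒length≤1 (Unique.filter⁺ _ chars-unique)
    λ a∈ b∈ → ¬leftSpecial⇒unique ¬ls (∈-leftExt⁻ u a∈) (∈-leftExt⁻ u b∈)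

  ¬rightSpecial⇒length-rightExt≤1 : ∀ u → ¬ RightSpecial u → length (rightExt S u) ≤ 1
  ¬rightSpecial⇒length-rightExt≤1 u ¬rs = Unique-constant⇒length≤1 (Unique.filter⁺ _ chars-unique)
    λ a∈ b∈ → ¬rightSpecial⇒unique ¬rs (∈-rightExt⁻ u a∈) (∈-rightExt⁻ u b∈)

  occurs-once-maximal⇒whole : ∀ w → ¬ 2 ≤ occ S w → Maximal S w → w ≡ S
  occurs-once-maximal⇒whole w occ<2 (inj₁ ls , _)      = ⊥-elim (occ<2 (leftSpecial⇒occ≥2 w ls))
  occurs-once-maximal⇒whole w occ<2 (inj₂ _ , inj₁ rs) = ⊥-elim (occ<2 (rightSpecial⇒occ≥2 w rs))
  occurs-once-maximal⇒whole w occ<2 (inj₂ pre , inj₂ suf)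
    with q , eq ← prefix⇒++ pre | p , eq' ← suffix⇒++ suf
    with refl ← occurs-once⇒unique-factorisation {x = w} occ<2 [] p eq (trans (cong (p ++_) (++-identityʳ w)) eq') = eq'

  sandwich : List A × A × A → List A
  sandwich (w , a , b) = a ∷ w ∷ʳ b

  sandwich-injective : Injective _≡_ _≡_ sandwich
  sandwich-injective {w , a , b} {w' , a' , b'} eq with refl , eq′ ← ∷-injective eq
    with refl , refl ← ∷ʳ-injective w w' eq′ = refl

  Sandwich : List A × A × A → Set
  Sandwich t = IsSubstr (sandwich t) S

  sandwich? : Decidable Sandwich
  sandwich? t = substr? (sandwich t) S

  charPairs : List (A × A)
  charPairs = cartesianProduct (chars S) (chars S)

  biExt : List A → List (A × A)
  biExt w = filter (sandwich? ∘ (w ,_)) charPairs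

  ∈-biExt⁺ : IsSubstr (a ∷ w ∷ʳ b) S → (a , b) ∈ biExt w
  ∈-biExt⁺ {a} {w} sub = ∈-filter⁺ _ (∈-cartesianProduct⁺ (head∈chars sub) (last∈chars {a ∷ w} sub)) sub

  occurs-once⇒extensions-combine : ¬ 2 ≤ occ S w → IsSubstr (a ∷ w) S → IsSubstr (w ∷ʳ b) S →
                                   IsSubstr (a ∷ w ∷ʳ b) S
  occurs-once⇒extensions-combine {w} {a} {b} occ<2 subᵃ subᵇ
    with p , q , eq ← substr⇒factor subᵃ | p' , q' , eq' ← substr⇒factor subᵇ
    with refl ← occurs-once⇒unique-factorisation {x = w} occ<2 (p ∷ʳ a) p' (factor-∷ p w eq) (factor-∷ʳ p' w eq')
    with refl ← ++-cancelˡ w _ _ (++-cancelˡ (p ∷ʳ a) _ _ (trans (factor-∷ p w eq) (sym (factor-∷ʳ p' w eq')))) =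
    factor⇒substr (p , q' , trans (cong (λ z → p ++ a ∷ z) (++-assoc w [ b ] q')) eq)

  Balanced : List A → Set
  Balanced w = length (leftExt S w) + length (rightExt S w) ≤ suc (length (biExt w))

  occurs-once⇒balanced : ∀ w → ¬ 2 ≤ occ S w → Balanced w
  occurs-once⇒balanced w occ<2 =
    length-+-length≤suc (leftExt S w) (rightExt S w)
      (¬leftSpecial⇒length-leftExt≤1 w (occ<2 ∘ leftSpecial⇒occ≥2 w))
      (¬rightSpecial⇒length-rightExt≤1 w (occ<2 ∘ rightSpecial⇒occ≥2 w))
      (λ a∈ b∈ → ∈-length (∈-biExt⁺ (occurs-once⇒extensions-combine occ<2 (∈-leftExt⁻ w a∈) (∈-rightExt⁻ w b∈))))

  ¬leftMaximal⇒balanced : IsSubstr w S → ¬ LeftMaximal S w → Balanced w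
  ¬leftMaximal⇒balanced {w} sub ¬lm with c , c∷w ← ¬prefix⇒leftExtensible sub (¬lm ∘ inj₂) =
    +-mono-≤ (¬leftSpecial⇒length-leftExt≤1 w (¬lm ∘ inj₁))
             (injective⇒length≤ (c ,_) (λ { refl → refl }) (Unique.filter⁺ _ chars-unique) into)
    where
    into : b ∈ rightExt S w → (c , b) ∈ biExt w
    into {b} b∈
      with c' , c'∷w∷ʳb ← ¬prefix⇒leftExtensible (∈-rightExt⁻ w b∈) (¬lm ∘ inj₂ ∘ prefix-++⁻ {w} {[ b ]})
      with refl ← ¬leftSpecial⇒unique (¬lm ∘ inj₁) c∷w (substr-++ˡ (c' ∷ w) [ b ] c'∷w∷ʳb) = ∈-biExt⁺ c'∷w∷ʳb

  ¬rightMaximal⇒balanced : IsSubstr w S → ¬ RightMaximal S w → Balanced w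
  ¬rightMaximal⇒balanced {w} sub ¬rm with c , w∷ʳc ← ¬suffix⇒rightExtensible sub (¬rm ∘ inj₂) =
    ≤-trans (+-mono-≤ (injective⇒length≤ (_, c) (λ { refl → refl }) (Unique.filter⁺ _ chars-unique) into)
                      (¬rightSpecial⇒length-rightExt≤1 w (¬rm ∘ inj₁)))
            (≤-reflexive (+-comm _ 1))
    where
    into : a ∈ leftExt S w → (a , c) ∈ biExt w
    into {a} a∈
      with c' , a∷w∷ʳc' ← ¬suffix⇒rightExtensible (∈-leftExt⁻ w a∈) (¬rm ∘ inj₂ ∘ suffix-∷⁻)
      with refl ← ¬rightSpecial⇒unique (¬rm ∘ inj₁) w∷ʳc (substr-++ʳ [ a ] (w ∷ʳ c') a∷w∷ʳc') = ∈-biExt⁺ a∷w∷ʳc'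

  ¬maximalRepeat⇒balanced : IsSubstr w S → ¬ MaximalRepeat S w → Balanced w
  ¬maximalRepeat⇒balanced {w} sub ¬mr with leftMaximal? S w | rightMaximal? S w | 2 ≤? occ S w
  ... | no ¬lm | _      | _         = ¬leftMaximal⇒balanced sub ¬lm
  ... | yes _  | no ¬rm | _         = ¬rightMaximal⇒balanced sub ¬rm
  ... | yes _  | yes _  | no occ<2  = occurs-once⇒balanced w occ<2
  ... | yes lm | yes rm | yes occ≥2 = ⊥-elim (¬mr ((lm , rm) , occ≥2))

  substrs-unique : Unique (substrs S)
  substrs-unique = deduplicate-! _≟ˢ_ (concatMap inits (tails S))

  leftCount rightCount biCount : List (List A) → ℕ
  leftCount  ws = sum (map (length ∘ leftExt S) ws)
  rightCount ws = sum (map (length ∘ rightExt S) ws)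
  biCount    ws = sum (map (length ∘ biExt) ws)

  LeftPair RightPair : List A × A → Set
  LeftPair  (w , a) = IsSubstr (a ∷ w) S
  RightPair (w , b) = IsSubstr (w ∷ʳ b) S

  leftPair? : Decidable LeftPair
  leftPair? (w , a) = substr? (a ∷ w) S

  rightPair? : Decidable RightPair
  rightPair? (w , b) = substr? (w ∷ʳ b) S

  length-substrs≤1+leftCount : length (substrs S) ≤ suc (leftCount (substrs S))
  length-substrs≤1+leftCount = begin
    length (substrs S)                            ≤⟨ Unique-⊆⇒length≤ substrs-unique covered ⟩
    suc (length (map (λ (w , a) → a ∷ w) pairs))  ≡⟨ cong suc (length-map _ pairs) ⟩
    suc (length pairs)                            ≡⟨ cong suc (length-filter-cartesianProduct leftPair? (substrs S) (chars S)) ⟩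
    suc (leftCount (substrs S))                   ∎
    where
    open ≤-Reasoning
    pairs = filter leftPair? (cartesianProduct (substrs S) (chars S))
    covered : substrs S ⊆ [] ∷ map (λ (w , a) → a ∷ w) pairs
    covered {[]}    _    = here refl
    covered {a ∷ w} a∷w∈ = there (∈-map⁺ _ (∈-filter⁺ leftPair? (∈-cartesianProduct⁺ w∈ (head∈chars sub)) sub))
      where
      sub = ∈-substrs⁻ a∷w∈
      w∈  = ∈-substrs⁺ (substr-++ʳ [ a ] w sub)

  length-substrs≤1+rightCount : length (substrs S) ≤ suc (rightCount (substrs S))
  length-substrs≤1+rightCount = begin
    length (substrs S)                            ≤⟨ Unique-⊆⇒length≤ substrs-unique covered ⟩
    suc (length (map (λ (w , b) → w ∷ʳ b) pairs)) ≡⟨ cong suc (length-map _ pairs) ⟩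
    suc (length pairs)                            ≡⟨ cong suc (length-filter-cartesianProduct rightPair? (substrs S) (chars S)) ⟩
    suc (rightCount (substrs S))                  ∎
    where
    open ≤-Reasoning
    pairs = filter rightPair? (cartesianProduct (substrs S) (chars S))
    covered : substrs S ⊆ [] ∷ map (λ (w , b) → w ∷ʳ b) pairs
    covered {x} x∈ with initLast x
    ... | []     = here refl
    ... | w ∷ʳ′ b = there (∈-map⁺ _ (∈-filter⁺ rightPair? (∈-cartesianProduct⁺ w∈ (last∈chars {w} sub)) sub))
      where
      sub = ∈-substrs⁻ x∈
      w∈  = ∈-substrs⁺ (substr-++ˡ w [ b ] sub)

  1+length-chars+biCount≤length-substrs : suc (length (chars S) + biCount (substrs S)) ≤ length (substrs S)
  1+length-chars+biCount≤length-substrs = begin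
    suc (length (chars S) + biCount (substrs S))
      ≡⟨ cong suc (cong₂ _+_ (sym (length-map [_] (chars S))) (sym (trans (length-map sandwich triples) count-triples))) ⟩
    suc (length (map [_] (chars S)) + length (map sandwich triples))
      ≡⟨ cong suc (length-++ (map [_] (chars S))) ⟨
    length witnesses
      ≤⟨ Unique-⊆⇒length≤ distinct covered ⟩
    length (substrs S) ∎
    where
    open ≤-Reasoning
    triples = filter sandwich? (cartesianProduct (substrs S) charPairs)
    count-triples = length-filter-cartesianProduct sandwich? (substrs S) charPairs
    witnesses = [] ∷ map [_] (chars S) ++ map sandwich triples

    nonempty : ∀ {x} → x ∈ map [_] (chars S) ++ map sandwich triples → [] ≢ x
    nonempty x∈ with ∈-++⁻ (map [_] (chars S)) x∈
    ... | inj₁ x∈₁ with _ , _ , refl ← ∈-map⁻ [_] x∈₁ = λ ()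
    ... | inj₂ x∈₂ with _ , _ , refl ← ∈-map⁻ sandwich x∈₂ = λ ()

    disjoint : ∀ {x} → ¬ (x ∈ map [_] (chars S) × x ∈ map sandwich triples)
    disjoint (x∈₁ , x∈₂) with _ , _ , refl ← ∈-map⁻ [_] x∈₁ | (w , _ , b) , _ , eq ← ∈-map⁻ sandwich x∈₂
      with () ← ++-conicalʳ w [ b ] (sym (proj₂ (∷-injective eq)))

    distinct : Unique witnesses
    distinct = All.tabulate nonempty
             ∷ Unique.++⁺ (Unique.map⁺ (λ { refl → refl }) chars-unique)
                          (Unique.map⁺ sandwich-injective
                            (Unique.filter⁺ sandwich?
                              (Unique.cartesianProduct⁺ substrs-unique (Unique.cartesianProduct⁺ chars-unique chars-unique))))
                          disjoint

    covered : witnesses ⊆ substrs S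
    covered (here refl) = ∈-substrs⁺ {S = S} (here [])
    covered (there x∈) with ∈-++⁻ (map [_] (chars S)) x∈
    ... | inj₁ x∈₁ with c , c∈ , refl ← ∈-map⁻ [_] x∈₁ = ∈-substrs⁺ (∈⇒singleton-substr (∈-deduplicate⁻ _≟_ S c∈))
    ... | inj₂ x∈₂ with t , t∈ , refl ← ∈-map⁻ sandwich x∈₂ =
      ∈-substrs⁺ (proj₂ (∈-filter⁻ sandwich? {xs = cartesianProduct (substrs S) charPairs} t∈))

  EBF⇒maximalRepeat : ∀ {a u b} → IsEBF S (a , u , b) → MaximalRepeat S u
  EBF⇒maximalRepeat {a} {u} {b} (sub , (a' , a'≢a , a'∷u) , (b' , b'≢b , u∷ʳb')) =
    (inj₁ leftSpecial , inj₁ rightSpecial) , leftSpecial⇒occ≥2 u leftSpecial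
    where
    leftSpecial : LeftSpecial u
    leftSpecial = a , a' , a'≢a ∘ sym , substr-++ˡ (a ∷ u) [ b ] sub , a'∷u
    rightSpecial : RightSpecial u
    rightSpecial = b , b' , b'≢b ∘ sym , substr-++ʳ [ a ] (u ∷ʳ b) sub , u∷ʳb'

  length-EBF≤biCount : length (EBF S) ≤ biCount (maxRepeats S)
  length-EBF≤biCount = begin
    length (EBF S)   ≤⟨ injective⇒length≤ middleFirst middleFirst-injective EBF-unique into ⟩
    length triples   ≡⟨ length-filter-cartesianProduct sandwich? (maxRepeats S) charPairs ⟩
    biCount (maxRepeats S) ∎
    where
    open ≤-Reasoning
    triples = filter sandwich? (cartesianProduct (maxRepeats S) charPairs)

    middleFirst : A × List A × A → List A × A × A
    middleFirst (a , u , b) = u , a , b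

    middleFirst-injective : Injective _≡_ _≡_ middleFirst
    middleFirst-injective {_ , _ , _} {_ , _ , _} refl = refl

    EBF-unique : Unique (EBF S)
    EBF-unique = Unique.filter⁺ (isEBF? S)
      (Unique.cartesianProduct⁺ chars-unique (Unique.cartesianProduct⁺ substrs-unique chars-unique))

    into : ∀ {t} → t ∈ EBF S → middleFirst t ∈ triples
    into {a , u , b} t∈ with t∈product , ebf ← ∈-filter⁻ (isEBF? S) t∈
      with a∈ , ub∈ ← ∈-cartesianProduct⁻ (chars S) _ t∈product
      with u∈ , b∈ ← ∈-cartesianProduct⁻ (substrs S) (chars S) ub∈ =
      ∈-filter⁺ sandwich?
        (∈-cartesianProduct⁺ (∈-filter⁺ (maximalRepeat? S) u∈ (EBF⇒maximalRepeat ebf)) (∈-cartesianProduct⁺ a∈ b∈))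
        (proj₁ ebf)

  length-V≤1+length-maxRepeats : length (V S) ≤ suc (length (maxRepeats S))
  length-V≤1+length-maxRepeats = Unique-⊆⇒length≤ (Unique.filter⁺ (maximal? S) substrs-unique) into
    where
    into : V S ⊆ S ∷ maxRepeats S
    into {w} w∈ with w∈substrs , maximal ← ∈-filter⁻ (maximal? S) {xs = substrs S} w∈ | 2 ≤? occ S w
    ... | yes occ≥2 = there (∈-filter⁺ (maximalRepeat? S) w∈substrs (maximal , occ≥2))
    ... | no  occ<2 = here (occurs-once-maximal⇒whole w occ<2 maximal)

  maxRepeats-balance : length (maxRepeats S) + length (chars S) + biCount (maxRepeats S)
                       ≤ suc (leftCount (maxRepeats S) + rightCount (maxRepeats S))
  maxRepeats-balance =
    extension-count-arith {o = length others} {eO = biCount others} {lO = leftCount others} {rO = rightCount others}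
    (length-filter+filter-∁ (maximalRepeat? S) (substrs S))
    (≤-trans length-substrs≤1+leftCount (≤-reflexive (cong suc (split (length ∘ leftExt S)))))
    (≤-trans length-substrs≤1+rightCount (≤-reflexive (cong suc (split (length ∘ rightExt S)))))
    (≤-trans (≤-reflexive (cong (suc ∘ (length (chars S) +_)) (sym (split (length ∘ biExt)))))
             1+length-chars+biCount≤length-substrs)
    (sum-+-sum≤sum-+-length (length ∘ leftExt S) (length ∘ rightExt S) (length ∘ biExt) others balanced)
    where
    others = filter (∁? (maximalRepeat? S)) (substrs S)
    split : ∀ f → sum (map f (substrs S)) ≡ sum (map f (maxRepeats S)) + sum (map f others)
    split f = sum-filter+filter-∁ (maximalRepeat? S) f (substrs S)
    balanced : ∀ {w} → w ∈ others → Balanced w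
    balanced w∈ with w∈substrs , ¬mr ← ∈-filter⁻ (∁? (maximalRepeat? S)) {xs = substrs S} w∈ =
      ¬maximalRepeat⇒balanced (∈-substrs⁻ w∈substrs) ¬mr

lemma5 : {Σ : Set} (_≟_ : DecidableEquality Σ) (S : List Σ) →
         let open Strings _≟_ in
         length (EBF S) + length (V S) ≤ r S + l S + 1
lemma5 _≟_ []        = s≤s z≤n
lemma5 _≟_ S@(_ ∷ _) = begin
  length (EBF S) + length (V S)              ≤⟨ +-mono-≤ length-EBF≤biCount length-V≤1+length-maxRepeats ⟩
  biCount MR + suc (length MR)               ≡⟨ +-comm (biCount MR) (suc (length MR)) ⟩
  suc (length MR) + biCount MR               ≡⟨ cong (_+ biCount MR) (+-comm 1 (length MR)) ⟩
  length MR + 1 + biCount MR                 ≤⟨ +-monoˡ-≤ (biCount MR) (+-monoʳ-≤ (length MR) (s≤s z≤n)) ⟩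
  length MR + length (chars S) + biCount MR  ≤⟨ maxRepeats-balance ⟩
  suc (l S + r S)                            ≡⟨ trans (cong suc (+-comm (l S) (r S))) (+-comm 1 (r S + l S)) ⟩
  r S + l S + 1                              ∎
  where
  open Strings _≟_
  open Extensions _≟_ S
  open ≤-Reasoning
  MR = maxRepeats S
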